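{- Let $p$ be the partially ordered pattern of length $4$ on the labels $\{1,2,3,4\}$ defined by the relations $1>2$, $1>3$ and $4>3$ (and no other relations besides those they imply; in particular $2$ and $4$ are incomparable). Let $a(n)$ be the number of $n$-permutations avoiding $p$. Then $a(0)=a(1)=1$ and, for $n\geq 2$, $a(n)=4a(n-1)-3a(n-2)+1$, so that $$a(n)=\frac{3^n-2n+3}{4}.$$ Also, $$\sum_{n\geq 0}a(n)x^n=\frac{(1-2x)^2}{(1-3x)(1-x)^2}.$$
   Context: An $n$-permutation is a permutation $\pi=\pi_1\cdots\pi_n$ of $\{1,\dots,n\}$ written in one-line notation (for $n=0$ there is exactly one, the empty permutation). A partially ordered pattern (POP) $p$ of length $k$ is a partial order $<_P$ on the label set $\{1,\dots,k\}$. An occurrence of $p$ in $\pi$ is a subsequence $\pi_{i_1}\pi_{i_2}\cdots\pi_{i_k}$ with $1\leq i_1<\cdots<i_k\leq n$ such that $\pi_{i_j}<\pi_{i_m}$ whenever $j<_P m$ (no condition is imposed on pairs of incomparable labels). A permutation avoids $p$ if it contains no occurrence of $p$. -}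

module Defs where

open import Data.Nat using (ℕ; zero; suc)
open import Data.Fin using (Fin; _<_)
open import Data.Vec using (Vec; lookup)
open import Data.Product using (Σ; ∃; _×_)
open import Data.List using (List; length)
open import Data.List.Relation.Unary.All using (All)
open import Data.List.Relation.Unary.Unique.Propositional using (Unique)
open import Data.List.Membership.Propositional using (_∈_)
open import Relation.Binary.PropositionalEquality using (_≡_)
open import Relation.Nullary using (¬_)
open import Function.Definitions using (Injective)

-- An n-permutation in one-line notation π₁⋯πₙ, values in Fin n (= {1..n} shifted by one).
IsPerm : {n : ℕ} → Vec (Fin n) n → Set
IsPerm π = Injective _≡_ _≡_ (lookup π)

Occurs : {n : ℕ} → Vec (Fin n) n → Set
Occurs {n} π =
  Σ (Fin n) λ i₁ → Σ (Fin n) λ i₂ → Σ (Fin n) λ i₃ → Σ (Fin n) λ i₄ →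
    (i₁ < i₂) × (i₂ < i₃) × (i₃ < i₄) ×
    (lookup π i₂ < lookup π i₁) × (lookup π i₃ < lookup π i₁) ×
    (lookup π i₃ < lookup π i₄)

Avoids : {n : ℕ} → Vec (Fin n) n → Set
Avoids π = ¬ Occurs π

AvoidingPerm : {n : ℕ} → Vec (Fin n) n → Set
AvoidingPerm π = IsPerm π × Avoids π

NumAvoiders : ℕ → ℕ → Set
NumAvoiders n m =
  Σ (List (Vec (Fin n) n)) λ L →
    Unique L × All AvoidingPerm L ×
    (∀ π → AvoidingPerm π → π ∈ L) × length L ≡ m

-- Every avoider of length n + 1 arises from an avoider σ of length n by inserting the maximum
-- n at some position m, and as the largest entry n can only play label 1 or label 4. It plays
-- label 4 iff σ has a wedge a < b < c < m (σ b, σ c < σ a), and label 1 iff σ has an ascent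
-- starting at a position ≥ m + 1. So if r is one more than the last start of an ascent of σ
-- (0 if σ is decreasing) and q the least end c of a wedge (n if there is none), the admissible
-- positions are exactly pred r ≤ m ≤ q, and the new pair (r, q) is determined by (r, q, m).
-- This is a generating tree with six kinds of labels. Label by label, the number of
-- grandchildren plus 3 is 4 times the number of children, plus 1 for the labels of the
-- decreasing permutation; as there is one decreasing permutation per length, summing over a
-- level gives a(n + 2) + 3 a(n) = 4 a(n + 1) + 1, from which the rest follows.
module Submission where

open import Defs
open import Data.Nat
  using (ℕ; zero; suc; pred; _+_; _*_; _^_; _⊔_; _≤_; _<_; z≤n; s≤s; s≤s⁻¹; _≤?_; _<?_)
open import Data.Nat.Properties
open import Data.Fin as Fin using (Fin; toℕ; fromℕ; fromℕ<; inject₁; lower₁; punchIn; punchOut)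
import Data.Fin.Properties as Finₚ
open import Data.Vec as Vec using (Vec; []; _∷_; lookup; insertAt; tabulate)
import Data.Vec.Properties as Vecₚ
open import Data.List using (List; []; _∷_; concatMap; length; applyUpTo) renaming (map to mapL)
open import Data.Nat.ListAction using (sum)
open import Data.Nat.ListAction.Properties using (sum-++)
import Data.List.Properties as Listₚ
open import Data.List.Relation.Unary.All as All using (All; []; _∷_)
import Data.List.Relation.Unary.All.Properties as Allₚ
open import Data.List.Relation.Unary.AllPairs as AllPairs using ([]; _∷_)
import Data.List.Relation.Unary.AllPairs.Properties as AllPairsₚ
open import Data.List.Relation.Unary.Any using (here)
open import Data.List.Relation.Unary.Unique.Propositional using (Unique)
import Data.List.Relation.Unary.Unique.Propositional.Properties as Uniqueₚ
open import Data.List.Relation.Binary.Disjoint.Propositional using (Disjoint)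
open import Data.List.Membership.Propositional using (_∈_)
open import Data.List.Membership.Propositional.Properties using (∈-map⁺; ∈-map⁻; ∈-concat⁺′; ∈-applyUpTo⁺)
open import Data.Product using (Σ; ∃; _×_; _,_; proj₁; proj₂)
open import Data.Sum using (_⊎_; inj₁; inj₂)
open import Data.Empty using (⊥-elim)
open import Relation.Nullary using (¬_; yes; no)
open import Relation.Nullary.Decidable using (decidable-stable)
open import Relation.Binary.PropositionalEquality
open import Function using (_∘_; const)
open import Function.Definitions using (Injective)
open import Data.Nat.Tactic.RingSolver using (solve-∀)
open import Data.Integer using (ℤ; +_) renaming (_+_ to _+ℤ_; _*_ to _*ℤ_; _-_ to _-ℤ_; -_ to -ℤ_)
import Data.Integer.Properties as ℤₚ
import Data.Integer.Tactic.RingSolver as ℤ-Solver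

private variable n t : ℕ

toℕ-punchIn-< : (i : Fin (suc n)) (j : Fin n) → toℕ j < toℕ i → toℕ (punchIn i j) ≡ toℕ j
toℕ-punchIn-< (Fin.suc i) Fin.zero    _         = refl
toℕ-punchIn-< (Fin.suc i) (Fin.suc j) (s≤s j<i) = cong suc (toℕ-punchIn-< i j j<i)

toℕ-punchIn-≥ : (i : Fin (suc n)) (j : Fin n) → toℕ i ≤ toℕ j → toℕ (punchIn i j) ≡ suc (toℕ j)
toℕ-punchIn-≥ Fin.zero    j           _         = refl
toℕ-punchIn-≥ (Fin.suc i) (Fin.suc j) (s≤s i≤j) = cong suc (toℕ-punchIn-≥ i j i≤j)

toℕ≤toℕ-punchIn : (i : Fin (suc n)) (j : Fin n) → toℕ j ≤ toℕ (punchIn i j)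
toℕ≤toℕ-punchIn Fin.zero    j           = n≤1+n _
toℕ≤toℕ-punchIn (Fin.suc i) Fin.zero    = z≤n
toℕ≤toℕ-punchIn (Fin.suc i) (Fin.suc j) = s≤s (toℕ≤toℕ-punchIn i j)

toℕ-punchIn≤suc : (i : Fin (suc n)) (j : Fin n) → toℕ (punchIn i j) ≤ suc (toℕ j)
toℕ-punchIn≤suc Fin.zero    j           = ≤-refl
toℕ-punchIn≤suc (Fin.suc i) Fin.zero    = z≤n
toℕ-punchIn≤suc (Fin.suc i) (Fin.suc j) = s≤s (toℕ-punchIn≤suc i j)

punchIn-mono-< : (i : Fin (suc n)) (j k : Fin n) → toℕ j < toℕ k → toℕ (punchIn i j) < toℕ (punchIn i k)
punchIn-mono-< Fin.zero    j           k           j<k       = s≤s j<k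
punchIn-mono-< (Fin.suc i) Fin.zero    (Fin.suc k) _         = s≤s z≤n
punchIn-mono-< (Fin.suc i) (Fin.suc j) (Fin.suc k) (s≤s j<k) = s≤s (punchIn-mono-< i j k j<k)

punchIn-cancel-< : (i : Fin (suc n)) (j k : Fin n) → toℕ (punchIn i j) < toℕ (punchIn i k) → toℕ j < toℕ k
punchIn-cancel-< i j k ↑j<↑k = ≰⇒> (λ k≤j → <⇒≱ ↑j<↑k (Finₚ.punchIn-mono-≤ i k j k≤j))

punchIn-onto : {i p : Fin (suc n)} → i ≢ p → ∃ λ j → punchIn i j ≡ p
punchIn-onto i≢p = punchOut i≢p , Finₚ.punchIn-punchOut i≢p

lookup-extensional : {A : Set} {xs ys : Vec A n} → (∀ p → lookup xs p ≡ lookup ys p) → xs ≡ ys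
lookup-extensional {xs = xs} {ys} eq =
  trans (sym (Vecₚ.tabulate∘lookup xs)) (trans (Vecₚ.tabulate-cong eq) (Vecₚ.tabulate∘lookup ys))

insertMax : Vec (Fin n) n → Fin (suc n) → Vec (Fin (suc n)) (suc n)
insertMax {n} σ i = insertAt (Vec.map inject₁ σ) i (fromℕ n)

AscentFrom : Vec (Fin n) n → ℕ → Set
AscentFrom {n} σ t = Σ (Fin n) λ j → Σ (Fin n) λ k →
  t ≤ toℕ j × toℕ j < toℕ k × toℕ (lookup σ j) < toℕ (lookup σ k)

WedgeBefore : Vec (Fin n) n → ℕ → Set
WedgeBefore {n} σ t = Σ (Fin n) λ a → Σ (Fin n) λ b → Σ (Fin n) λ c →
  toℕ a < toℕ b × toℕ b < toℕ c × toℕ c < t ×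
  toℕ (lookup σ b) < toℕ (lookup σ a) × toℕ (lookup σ c) < toℕ (lookup σ a)

ascentFrom-anti : ∀ {σ : Vec (Fin n) n} {s} → s ≤ t → AscentFrom σ t → AscentFrom σ s
ascentFrom-anti s≤t (j , k , t≤j , rest) = j , k , ≤-trans s≤t t≤j , rest

record Thresholds (σ : Vec (Fin n) n) (r q : ℕ) : Set where
  field
    q≤n           : q ≤ n
    ascentFrom    : ∀ {t} → t < r → AscentFrom σ t
    noAscentFrom  : ∀ {t} → r ≤ t → ¬ AscentFrom σ t
    wedgeBefore   : ∀ {t} → q < t → t ≤ n → WedgeBefore σ t
    noWedgeBefore : ∀ {t} → t ≤ q → ¬ WedgeBefore σ t
open Thresholds

-- The thresholds r′ and q′ after inserting the maximum at position m; q′ = min (q + 1) (m + 2).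
data AscentStep (r m : ℕ) : ℕ → Set where
  beyond   : r ≤ m → AscentStep r m m
  adjacent : r ≡ suc m → AscentStep r m (suc (suc m))

data WedgeStep (q m : ℕ) : ℕ → Set where
  shift : q ≤ suc m → WedgeStep q m (suc q)
  cap   : suc m ≤ q → WedgeStep q m (suc (suc m))

ascentStep⇒≤ : ∀ {r m r′} → AscentStep r m r′ → r ≤ suc m
ascentStep⇒≤ (beyond r≤m)     = ≤-trans r≤m (n≤1+n _)
ascentStep⇒≤ (adjacent r≡1+m) = ≤-reflexive r≡1+m

wedgeStep≤suc : ∀ {q m q′} → WedgeStep q m q′ → q′ ≤ suc q
wedgeStep≤suc (shift _)     = ≤-refl
wedgeStep≤suc (cap 1+m≤q)   = s≤s 1+m≤q

wedgeStep≤2+m : ∀ {q m q′} → WedgeStep q m q′ → q′ ≤ suc (suc m)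
wedgeStep≤2+m (shift q≤1+m) = s≤s q≤1+m
wedgeStep≤2+m (cap _)       = ≤-refl

module InsertMax (σ : Vec (Fin n) n) (i : Fin (suc n)) where

  π : Vec (Fin (suc n)) (suc n)
  π = insertMax σ i

  m : ℕ
  m = toℕ i

  value : Fin (suc n) → ℕ
  value p = toℕ (lookup π p)

  lookup-self : lookup π i ≡ fromℕ n
  lookup-self = Vecₚ.insertAt-lookup (Vec.map inject₁ σ) i (fromℕ n)

  value-self : value i ≡ n
  value-self = trans (cong toℕ lookup-self) (Finₚ.toℕ-fromℕ n)

  lookup-punchIn : ∀ j → lookup π (punchIn i j) ≡ inject₁ (lookup σ j)
  lookup-punchIn j = trans (Vecₚ.insertAt-punchIn (Vec.map inject₁ σ) i (fromℕ n) j) (Vecₚ.lookup-map j inject₁ σ)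

  value-punchIn : ∀ j → value (punchIn i j) ≡ toℕ (lookup σ j)
  value-punchIn j = trans (cong toℕ (lookup-punchIn j)) (Finₚ.toℕ-inject₁ (lookup σ j))

  lift-< : ∀ {j k} → toℕ (lookup σ j) < toℕ (lookup σ k) → value (punchIn i j) < value (punchIn i k)
  lift-< {j} {k} = subst₂ _<_ (sym (value-punchIn j)) (sym (value-punchIn k))

  lower-< : ∀ {j k} → value (punchIn i j) < value (punchIn i k) → toℕ (lookup σ j) < toℕ (lookup σ k)
  lower-< {j} {k} = subst₂ _<_ (value-punchIn j) (value-punchIn k)

  value<self : ∀ {p} → i ≢ p → value p < value i
  value<self {p} i≢p with punchIn-onto i≢p
  ... | j , refl = subst₂ _<_ (sym (value-punchIn j)) (sym value-self) (Finₚ.toℕ<n (lookup σ j))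

  smaller⇒≢ : ∀ {p q} → value p < value q → i ≢ p
  smaller⇒≢ {q = q} vp<vq refl =
    <-irrefl refl (<-≤-trans (subst (_< value q) value-self vp<vq) (s≤s⁻¹ (Finₚ.toℕ<n (lookup π q))))

  <m⇒≢ : ∀ {p} → toℕ p < m → i ≢ p
  <m⇒≢ p<m i≡p = <-irrefl (cong toℕ (sym i≡p)) p<m

  >m⇒≢ : ∀ {p} → m < toℕ p → i ≢ p
  >m⇒≢ m<p i≡p = <-irrefl (cong toℕ i≡p) m<p

  below : ∀ {p} → toℕ p < m → ∃ λ j → punchIn i j ≡ p × toℕ j ≡ toℕ p
  below p<m with punchIn-onto (<m⇒≢ p<m)
  ... | j , refl = j , refl , sym (toℕ-punchIn-< i j (≤-<-trans (toℕ≤toℕ-punchIn i j) p<m))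

  above : ∀ {p} → m < toℕ p → ∃ λ j → punchIn i j ≡ p × suc (toℕ j) ≡ toℕ p
  above m<p with punchIn-onto (>m⇒≢ m<p)
  ... | j , refl with toℕ j <? m
  ...   | yes j<m = ⊥-elim (<-asym m<p (subst (_< m) (sym (toℕ-punchIn-< i j j<m)) j<m))
  ...   | no  j≮m = j , refl , sym (toℕ-punchIn-≥ i j (≮⇒≥ j≮m))

  ascentFrom-below : t < m → AscentFrom π t
  ascentFrom-below {t} t<m = p , i , ≤-reflexive (sym p≡t) , p<m , value<self (<m⇒≢ p<m)
    where
      p = fromℕ< (<-trans t<m (Finₚ.toℕ<n i))
      p≡t : toℕ p ≡ t
      p≡t = Finₚ.toℕ-fromℕ< _
      p<m : toℕ p < m
      p<m = subst (_< m) (sym p≡t) t<m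

  ascentFrom-lift : m ≤ t → AscentFrom σ t → AscentFrom π (suc t)
  ascentFrom-lift m≤t (j , k , t≤j , j<k , vj<vk) =
    punchIn i j , punchIn i k ,
    subst (suc _ ≤_) (sym (toℕ-punchIn-≥ i j (≤-trans m≤t t≤j))) (s≤s t≤j) ,
    punchIn-mono-< i j k j<k , lift-< vj<vk

  ≤-smaller⇒> : ∀ {p q} → m ≤ toℕ p → value p < value q → m < toℕ p
  ≤-smaller⇒> m≤p vp<vq = ≤∧≢⇒< m≤p (smaller⇒≢ vp<vq ∘ Finₚ.toℕ-injective)

  ascentFrom-lower : ∀ {t} → m ≤ t → AscentFrom π t → AscentFrom σ (m ⊔ pred t)
  ascentFrom-lower {t} m≤t (p , q , t≤p , p<q , vp<vq) = lower (≤-smaller⇒> (≤-trans m≤t t≤p) vp<vq)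
    where
      lower : m < toℕ p → AscentFrom σ (m ⊔ pred t)
      lower m<p with above m<p | above (<-trans m<p p<q)
      ... | j , refl , 1+j≡p | k , refl , _ =
        j , k ,
        ⊔-lub (s≤s⁻¹ (subst (m <_) (sym 1+j≡p) m<p)) (pred-mono-≤ (subst (t ≤_) (sym 1+j≡p) t≤p)) ,
        punchIn-cancel-< i j k p<q , lower-< vp<vq

  wedgeBefore-lower : ∀ {t} → t ≤ m → WedgeBefore π t → WedgeBefore σ t
  wedgeBefore-lower {t} t≤m (a , b , c , a<b , b<c , c<t , vb<va , vc<va)
    with below (<-trans a<b (<-trans b<c (<-≤-trans c<t t≤m)))
       | below (<-trans b<c (<-≤-trans c<t t≤m))
       | below (<-≤-trans c<t t≤m)
  ... | ja , refl , _ | jb , refl , _ | jc , refl , jc≡c =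
    ja , jb , jc , punchIn-cancel-< i ja jb a<b , punchIn-cancel-< i jb jc b<c ,
    subst (_< t) (sym jc≡c) c<t , lower-< vb<va , lower-< vc<va

  wedgeBefore-lower-suc : ∀ {t} → m ≤ t → t ≤ suc m → WedgeBefore π (suc t) → WedgeBefore σ t
  wedgeBefore-lower-suc {t} m≤t t≤1+m (a , b , c , a<b , b<c , c<1+t , vb<va , vc<va)
    with punchIn-onto (<m⇒≢ (s≤s⁻¹ (≤-trans (≤-trans (s≤s a<b) b<c) (≤-trans (s≤s⁻¹ c<1+t) t≤1+m))))
       | punchIn-onto (smaller⇒≢ vb<va)
       | punchIn-onto (smaller⇒≢ vc<va)
  ... | ja , refl | jb , refl | jc , refl =
    ja , jb , jc , punchIn-cancel-< i ja jb a<b , punchIn-cancel-< i jb jc b<c , jc<t ,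
    lower-< vb<va , lower-< vc<va
    where
      jc<t : toℕ jc < t
      jc<t with toℕ jc <? m
      ... | yes jc<m = <-≤-trans jc<m m≤t
      ... | no  jc≮m = s≤s⁻¹ (subst (_< suc t) (toℕ-punchIn-≥ i jc (≮⇒≥ jc≮m)) c<1+t)

  wedgeBefore-lift : ∀ {t} → WedgeBefore σ t → WedgeBefore π (suc t)
  wedgeBefore-lift (a , b , c , a<b , b<c , c<t , vb<va , vc<va) =
    punchIn i a , punchIn i b , punchIn i c ,
    punchIn-mono-< i a b a<b , punchIn-mono-< i b c b<c , ≤-<-trans (toℕ-punchIn≤suc i c) (s≤s c<t) ,
    lift-< vb<va , lift-< vc<va

  wedgeBefore-after : ∀ {t} → suc (suc m) < t → t ≤ suc n → WedgeBefore π t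
  wedgeBefore-after {t} 2+m<t t≤1+n =
    i , p₁ , p₂ , m<p₁ , p₁<p₂ , subst (_< t) (sym toℕ-p₂) 2+m<t ,
    value<self (>m⇒≢ m<p₁) , value<self (>m⇒≢ (<-trans m<p₁ p₁<p₂))
    where
      2+m<1+n : suc (suc m) < suc n
      2+m<1+n = <-≤-trans 2+m<t t≤1+n
      1+m<1+n : suc m < suc n
      1+m<1+n = <-trans (n<1+n (suc m)) 2+m<1+n
      p₁ p₂ : Fin (suc n)
      p₁ = fromℕ< 1+m<1+n
      p₂ = fromℕ< 2+m<1+n
      toℕ-p₁ : toℕ p₁ ≡ suc m
      toℕ-p₁ = Finₚ.toℕ-fromℕ< 1+m<1+n
      toℕ-p₂ : toℕ p₂ ≡ suc (suc m)
      toℕ-p₂ = Finₚ.toℕ-fromℕ< 2+m<1+n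
      m<p₁ : m < toℕ p₁
      m<p₁ = subst (m <_) (sym toℕ-p₁) (n<1+n m)
      p₁<p₂ : toℕ p₁ < toℕ p₂
      p₁<p₂ = subst₂ _<_ (sym toℕ-p₁) (sym toℕ-p₂) (n<1+n (suc m))

  occurs-lift : Occurs σ → Occurs π
  occurs-lift (a , b , c , d , a<b , b<c , c<d , vb<va , vc<va , vc<vd) =
    punchIn i a , punchIn i b , punchIn i c , punchIn i d ,
    punchIn-mono-< i a b a<b , punchIn-mono-< i b c b<c , punchIn-mono-< i c d c<d ,
    lift-< vb<va , lift-< vc<va , lift-< vc<vd

  wedge⇒occurs : WedgeBefore σ m → Occurs π
  wedge⇒occurs (a , b , c , a<b , b<c , c<m , vb<va , vc<va) =
    punchIn i a , punchIn i b , punchIn i c , i ,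
    punchIn-mono-< i a b a<b , punchIn-mono-< i b c b<c , subst (_< m) (sym (toℕ-punchIn-< i c c<m)) c<m ,
    lift-< vb<va , lift-< vc<va , value<self (Finₚ.punchInᵢ≢i i c ∘ sym)

  ascent⇒occurs : AscentFrom σ (suc m) → Occurs π
  ascent⇒occurs ascent with ascentFrom-lift (n≤1+n m) ascent
  ... | p , q , 1+m<p , p<q , vp<vq =
    i , p₁ , p , q , m<p₁ , p₁<p , p<q ,
    value<self (>m⇒≢ m<p₁) , value<self (>m⇒≢ (<-trans m<p₁ p₁<p)) , vp<vq
    where
      1+m<1+n : suc m < suc n
      1+m<1+n = <-trans 1+m<p (Finₚ.toℕ<n p)
      p₁ : Fin (suc n)
      p₁ = fromℕ< 1+m<1+n
      toℕ-p₁ : toℕ p₁ ≡ suc m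
      toℕ-p₁ = Finₚ.toℕ-fromℕ< 1+m<1+n
      m<p₁ : m < toℕ p₁
      m<p₁ = subst (m <_) (sym toℕ-p₁) (n<1+n m)
      p₁<p : toℕ p₁ < toℕ p
      p₁<p = subst (_< toℕ p) (sym toℕ-p₁) 1+m<p

  occurs⁻ : Occurs π → Occurs σ ⊎ WedgeBefore σ m ⊎ AscentFrom σ (suc m)
  occurs⁻ (a , b , c , d , a<b , b<c , c<d , vb<va , vc<va , vc<vd) with i Finₚ.≟ a | i Finₚ.≟ d
  ... | yes refl | _ =
    inj₂ (inj₂ (ascentFrom-anti {σ = σ} (m≤n⊔m m (suc m))
      (ascentFrom-lower (≤-trans (n≤1+n m) (n≤1+n (suc m))) (c , d , ≤-trans (s≤s a<b) b<c , c<d , vc<vd))))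
  ... | no _ | yes refl =
    inj₂ (inj₁ (wedgeBefore-lower ≤-refl (a , b , c , a<b , b<c , c<d , vb<va , vc<va)))
  ... | no i≢a | no i≢d
    with punchIn-onto i≢a | punchIn-onto (smaller⇒≢ vb<va) | punchIn-onto (smaller⇒≢ vc<va) | punchIn-onto i≢d
  ...  | ja , refl | jb , refl | jc , refl | jd , refl =
    inj₁ (ja , jb , jc , jd ,
      punchIn-cancel-< i ja jb a<b , punchIn-cancel-< i jb jc b<c , punchIn-cancel-< i jc jd c<d ,
      lower-< vb<va , lower-< vc<va , lower-< vc<vd)

  occurs⁺ : Occurs σ ⊎ WedgeBefore σ m ⊎ AscentFrom σ (suc m) → Occurs π
  occurs⁺ (inj₁ o)        = occurs-lift o
  occurs⁺ (inj₂ (inj₁ w)) = wedge⇒occurs w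
  occurs⁺ (inj₂ (inj₂ a)) = ascent⇒occurs a

  isPerm : IsPerm σ → IsPerm π
  isPerm σ-perm {p} {q} πp≡πq with i Finₚ.≟ p | i Finₚ.≟ q
  ... | yes refl | yes refl = refl
  ... | yes refl | no i≢q   = ⊥-elim (<-irrefl (cong toℕ (sym πp≡πq)) (value<self i≢q))
  ... | no i≢p   | yes refl = ⊥-elim (<-irrefl (cong toℕ πp≡πq) (value<self i≢p))
  ... | no i≢p   | no i≢q with punchIn-onto i≢p | punchIn-onto i≢q
  ...   | j , refl | k , refl =
    cong (punchIn i) (σ-perm (Finₚ.inject₁-injective (trans (sym (lookup-punchIn j)) (trans πp≡πq (lookup-punchIn k)))))

  avoids⁺ : ∀ {r q} → Thresholds σ r q → Avoids σ → m ≤ q → r ≤ suc m → Avoids π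
  avoids⁺ th σ-avoids m≤q r≤1+m o with occurs⁻ o
  ... | inj₁ σ-occurrence  = σ-avoids σ-occurrence
  ... | inj₂ (inj₁ wedge)  = noWedgeBefore th m≤q wedge
  ... | inj₂ (inj₂ ascent) = noAscentFrom th r≤1+m ascent

  avoids-lower : Avoids π → Avoids σ
  avoids-lower π-avoids = π-avoids ∘ occurs-lift

  avoids⁻ : ∀ {r q} → Thresholds σ r q → Avoids π → m ≤ q × r ≤ suc m
  avoids⁻ {r} {q} th π-avoids =
    decidable-stable (m ≤? q) (λ m≰q →
      π-avoids (occurs⁺ (inj₂ (inj₁ (wedgeBefore th (≰⇒> m≰q) (s≤s⁻¹ (Finₚ.toℕ<n i))))))) ,
    decidable-stable (r ≤? suc m) (λ r≰1+m →
      π-avoids (occurs⁺ (inj₂ (inj₂ (ascentFrom th (≰⇒> r≰1+m))))))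

  thresholds⁺ : ∀ {r q r′ q′} → Thresholds σ r q → m ≤ q → AscentStep r m r′ → WedgeStep q m q′ →
    Thresholds π r′ q′
  thresholds⁺ {r} {q} {r′} {q′} th m≤q step wstep = record
    { q≤n           = ≤-trans (wedgeStep≤suc wstep) (s≤s (q≤n th))
    ; ascentFrom    = ascents step
    ; noAscentFrom  = noAscents step
    ; wedgeBefore   = wedges wstep
    ; noWedgeBefore = noWedges
    }
    where
      ascents : AscentStep r m r′ → ∀ {t} → t < r′ → AscentFrom π t
      ascents (beyond _)             = ascentFrom-below
      ascents (adjacent r≡1+m) t<2+m = ascentFrom-anti {σ = π} (s≤s⁻¹ t<2+m)
        (ascentFrom-lift ≤-refl (ascentFrom th (subst (m <_) (sym r≡1+m) (n<1+n m))))

      noAscents : AscentStep r m r′ → ∀ {t} → r′ ≤ t → ¬ AscentFrom π t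
      noAscents (beyond r≤m) m≤t ascent =
        noAscentFrom th (≤-trans r≤m (m≤m⊔n m _)) (ascentFrom-lower m≤t ascent)
      noAscents (adjacent refl) 2+m≤t ascent =
        noAscentFrom th (≤-trans (pred-mono-≤ 2+m≤t) (m≤n⊔m m _))
          (ascentFrom-lower (≤-trans (n≤1+n m) (≤-trans (n≤1+n _) 2+m≤t)) ascent)

      wedges : WedgeStep q m q′ → ∀ {t} → q′ < t → t ≤ suc n → WedgeBefore π t
      wedges (shift _) {suc t} 1+q<1+t 1+t≤1+n =
        wedgeBefore-lift (wedgeBefore th (s≤s⁻¹ 1+q<1+t) (s≤s⁻¹ 1+t≤1+n))
      wedges (cap _) = wedgeBefore-after

      noWedges : ∀ {t} → t ≤ q′ → ¬ WedgeBefore π t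
      noWedges {t} t≤q′ wedge with t ≤? m
      ... | yes t≤m = noWedgeBefore th (≤-trans t≤m m≤q) (wedgeBefore-lower t≤m wedge)
      noWedges {zero}  _    _     | no t≰m = t≰m z≤n
      noWedges {suc t} t<q′ wedge | no t≰m =
        noWedgeBefore th (s≤s⁻¹ (≤-trans t<q′ (wedgeStep≤suc wstep)))
          (wedgeBefore-lower-suc (s≤s⁻¹ (≰⇒> t≰m)) (s≤s⁻¹ (≤-trans t<q′ (wedgeStep≤2+m wstep))) wedge)

insertMax-injective : {σ τ : Vec (Fin n) n} {i j : Fin (suc n)} → insertMax σ i ≡ insertMax τ j → i ≡ j × σ ≡ τ
insertMax-injective {n} {σ} {τ} {i} {j} eq with j Finₚ.≟ i
... | no j≢i = ⊥-elim (<-irrefl refl (subst₂ _<_ value-at-i (InsertMax.value-self τ j) (InsertMax.value<self τ j j≢i)))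
  where
    value-at-i : toℕ (lookup (insertMax τ j) i) ≡ n
    value-at-i = trans (cong (λ π → toℕ (lookup π i)) (sym eq)) (InsertMax.value-self σ i)
... | yes refl = refl , lookup-extensional λ k → Finₚ.inject₁-injective
  (trans (sym (InsertMax.lookup-punchIn σ i k)) (trans (cong (λ π → lookup π (punchIn i k)) eq) (InsertMax.lookup-punchIn τ i k)))

insertMax-apart : {σ : Vec (Fin n) n} {m m′ : ℕ} .{p : m < suc n} .{p′ : m′ < suc n} →
  m ≢ m′ → insertMax σ (fromℕ< p) ≢ insertMax σ (fromℕ< p′)
insertMax-apart {p = p} {p′} m≢m′ eq =
  m≢m′ (trans (sym (Finₚ.toℕ-fromℕ< p)) (trans (cong toℕ (proj₁ (insertMax-injective eq))) (Finₚ.toℕ-fromℕ< p′)))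

isPerm⇒hasMax : (π : Vec (Fin (suc n)) (suc n)) → IsPerm π → ∃ λ i → lookup π i ≡ fromℕ n
isPerm⇒hasMax {n} π π-perm with Finₚ.any? (λ p → lookup π p Finₚ.≟ fromℕ n)
... | yes found = found
... | no  none  = ⊥-elim (<-irrefl refl (Finₚ.injective⇒≤ lowered-injective))
  where
    n≢π : ∀ p → n ≢ toℕ (lookup π p)
    n≢π p n≡πp = none (p , Finₚ.toℕ-injective (trans (sym n≡πp) (sym (Finₚ.toℕ-fromℕ n))))
    lowered-injective : Injective _≡_ _≡_ (λ p → lower₁ (lookup π p) (n≢π p))
    lowered-injective eq = π-perm (Finₚ.lower₁-injective eq)

isPerm⇒insertMax : (π : Vec (Fin (suc n)) (suc n)) → IsPerm π →
  Σ (Fin (suc n)) λ i → Σ (Vec (Fin n) n) λ τ → IsPerm τ × insertMax τ i ≡ π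
isPerm⇒insertMax {n} π π-perm with isPerm⇒hasMax π π-perm
... | i , πi≡max = i , τ , τ-perm , lookup-extensional insertMax-τ≗π
  where
    n≢π∘punchIn : ∀ j → n ≢ toℕ (lookup π (punchIn i j))
    n≢π∘punchIn j n≡ = Finₚ.punchInᵢ≢i i j
      (π-perm (trans (Finₚ.toℕ-injective (trans (sym n≡) (sym (Finₚ.toℕ-fromℕ n)))) (sym πi≡max)))
    f : Fin n → Fin n
    f j = lower₁ (lookup π (punchIn i j)) (n≢π∘punchIn j)
    τ : Vec (Fin n) n
    τ = tabulate f
    τ-perm : IsPerm τ
    τ-perm {j} {k} eq = Finₚ.punchIn-injective i j k (π-perm (Finₚ.lower₁-injective
      (trans (sym (Vecₚ.lookup∘tabulate f j)) (trans eq (Vecₚ.lookup∘tabulate f k)))))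
    insertMax-τ≗π : ∀ p → lookup (insertMax τ i) p ≡ lookup π p
    insertMax-τ≗π p with i Finₚ.≟ p
    ... | yes refl = trans (InsertMax.lookup-self τ i) (sym πi≡max)
    ... | no i≢p with punchIn-onto i≢p
    ...   | j , refl = trans (InsertMax.lookup-punchIn τ i j)
      (trans (cong inject₁ (Vecₚ.lookup∘tabulate f j)) (Finₚ.inject₁-lower₁ _ (n≢π∘punchIn j)))

-- The generating tree

-- desc k labels the decreasing permutation (no ascent, so r = 0); gap k labels q = r + k.
data Label : Set where
  desc₀ desc₁ desc₂ gap₀ gap₁ gap₂ : Label

ascentBound : Label → ℕ → ℕ
ascentBound desc₀ _ = 0
ascentBound desc₁ _ = 0
ascentBound desc₂ _ = 0
ascentBound gap₀  l = suc l
ascentBound gap₁  l = suc l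
ascentBound gap₂  l = suc l

wedgeBound : Label → ℕ → ℕ
wedgeBound desc₀ _ = 0
wedgeBound desc₁ _ = 1
wedgeBound desc₂ _ = 2
wedgeBound gap₀  l = suc l
wedgeBound gap₁  l = suc (suc l)
wedgeBound gap₂  l = suc (suc (suc l))

record Avoider (n : ℕ) : Set where
  constructor avoider
  field
    perm       : Vec (Fin n) n
    isPerm     : IsPerm perm
    avoids     : Avoids perm
    label      : Label
    offset     : ℕ
    thresholds : Thresholds perm (ascentBound label offset) (wedgeBound label offset)
open Avoider

ascentBoundOf wedgeBoundOf : Avoider n → ℕ
ascentBoundOf e = ascentBound (label e) (offset e)
wedgeBoundOf  e = wedgeBound  (label e) (offset e)

record ChildSpec (e : Avoider n) : Set where
  constructor spec
  field
    position   : ℕ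
    label′     : Label
    offset′    : ℕ
    position≤q : position ≤ wedgeBoundOf e
    ascentStep : AscentStep (ascentBoundOf e) position (ascentBound label′ offset′)
    wedgeStep  : WedgeStep (wedgeBoundOf e) position (wedgeBound label′ offset′)
open ChildSpec

child : (e : Avoider n) → ChildSpec e → Avoider (suc n)
child {n} e s =
  avoider (insertMax (perm e) i) (InsertMax.isPerm (perm e) i (isPerm e)) (proj₁ grown) (label′ s) (offset′ s) (proj₂ grown)
  where
    m<1+n : position s < suc n
    m<1+n = s≤s (≤-trans (position≤q s) (q≤n (thresholds e)))
    i : Fin (suc n)
    i = fromℕ< m<1+n
    Grown : ℕ → Set
    Grown x = x ≤ wedgeBoundOf e → AscentStep (ascentBoundOf e) x (ascentBound (label′ s) (offset′ s)) →
      WedgeStep (wedgeBoundOf e) x (wedgeBound (label′ s) (offset′ s)) →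
      Avoids (insertMax (perm e) i) ×
      Thresholds (insertMax (perm e) i) (ascentBound (label′ s) (offset′ s)) (wedgeBound (label′ s) (offset′ s))
    grow : Grown (toℕ i)
    grow x≤q xstep xwstep =
      InsertMax.avoids⁺ (perm e) i (thresholds e) (avoids e) x≤q (ascentStep⇒≤ xstep) ,
      InsertMax.thresholds⁺ (perm e) i (thresholds e) x≤q xstep xwstep
    -- Only the proofs are transported along toℕ i ≡ position s: the permutation of the child
    -- stays definitionally insertMax (perm e) i.
    grown = subst Grown (Finₚ.toℕ-fromℕ< m<1+n) grow (position≤q s) (ascentStep s) (wedgeStep s)

childSpecs : (e : Avoider n) → List (ChildSpec e)
childSpecs (avoider _ _ _ desc₀ _ _) =
  spec 0 desc₁ 0 z≤n (beyond z≤n) (shift z≤n) ∷ []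
childSpecs (avoider _ _ _ desc₁ _ _) =
  spec 0 desc₂ 0 z≤n (beyond z≤n) (shift (s≤s z≤n)) ∷
  spec 1 gap₁  0 ≤-refl (beyond z≤n) (shift (s≤s z≤n)) ∷ []
childSpecs (avoider _ _ _ desc₂ _ _) =
  spec 0 desc₂ 0 z≤n (beyond z≤n) (cap (s≤s z≤n)) ∷
  spec 1 gap₂  0 (s≤s z≤n) (beyond z≤n) (shift ≤-refl) ∷
  spec 2 gap₁  1 ≤-refl (beyond z≤n) (shift (n≤1+n 2)) ∷ []
childSpecs (avoider _ _ _ gap₀ l _) =
  spec l       gap₀ (suc l) (n≤1+n l) (adjacent refl) (shift ≤-refl) ∷
  spec (suc l) gap₁ l       ≤-refl (beyond ≤-refl) (shift (n≤1+n _)) ∷ []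
childSpecs (avoider _ _ _ gap₁ l _) =
  spec l             gap₀ (suc l) (m≤n+m l 2) (adjacent refl) (cap (n≤1+n _)) ∷
  spec (suc l)       gap₂ l       (n≤1+n _) (beyond ≤-refl) (shift ≤-refl) ∷
  spec (suc (suc l)) gap₁ (suc l) ≤-refl (beyond (n≤1+n _)) (shift (n≤1+n _)) ∷ []
childSpecs (avoider _ _ _ gap₂ l _) =
  spec l                   gap₀ (suc l)       (m≤n+m l 3) (adjacent refl) (cap (m≤n+m (suc l) 2)) ∷
  spec (suc l)             gap₂ l             (m≤n+m (suc l) 2) (beyond ≤-refl) (cap (n≤1+n _)) ∷
  spec (suc (suc l))       gap₂ (suc l)       (n≤1+n _) (beyond (n≤1+n _)) (shift ≤-refl) ∷
  spec (suc (suc (suc l))) gap₁ (suc (suc l)) ≤-refl (beyond (m≤n+m (suc l) 2)) (shift (n≤1+n _)) ∷ []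

children : Avoider n → List (Avoider (suc n))
children e = mapL (child e) (childSpecs e)

childLabels : Label → List Label
childLabels desc₀ = desc₁ ∷ []
childLabels desc₁ = desc₂ ∷ gap₁ ∷ []
childLabels desc₂ = desc₂ ∷ gap₂ ∷ gap₁ ∷ []
childLabels gap₀  = gap₀ ∷ gap₁ ∷ []
childLabels gap₁  = gap₀ ∷ gap₂ ∷ gap₁ ∷ []
childLabels gap₂  = gap₀ ∷ gap₂ ∷ gap₂ ∷ gap₁ ∷ []

lowestPosition : Avoider n → ℕ
lowestPosition e = pred (ascentBoundOf e)

childSpecs-shape : (e : Avoider n) →
  mapL label′ (childSpecs e) ≡ childLabels (label e) ×
  mapL position (childSpecs e) ≡ applyUpTo (_+ lowestPosition e) (length (childLabels (label e)))
childSpecs-shape (avoider _ _ _ desc₀ _ _) = refl , refl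
childSpecs-shape (avoider _ _ _ desc₁ _ _) = refl , refl
childSpecs-shape (avoider _ _ _ desc₂ _ _) = refl , refl
childSpecs-shape (avoider _ _ _ gap₀  _ _) = refl , refl
childSpecs-shape (avoider _ _ _ gap₁  _ _) = refl , refl
childSpecs-shape (avoider _ _ _ gap₂  _ _) = refl , refl

childLabels-count : (e : Avoider n) → length (childLabels (label e)) + lowestPosition e ≡ suc (wedgeBoundOf e)
childLabels-count (avoider _ _ _ desc₀ _ _) = refl
childLabels-count (avoider _ _ _ desc₁ _ _) = refl
childLabels-count (avoider _ _ _ desc₂ _ _) = refl
childLabels-count (avoider _ _ _ gap₀  _ _) = refl
childLabels-count (avoider _ _ _ gap₁  _ _) = refl
childLabels-count (avoider _ _ _ gap₂  _ _) = refl

children-labels : (e : Avoider n) → mapL label (children e) ≡ childLabels (label e)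
children-labels e = trans (sym (Listₚ.map-∘ (childSpecs e))) (proj₁ (childSpecs-shape e))

children-insertMax : (e : Avoider n) → All (λ π → ∃ λ i → π ≡ insertMax (perm e) i) (mapL perm (children e))
children-insertMax e = Allₚ.map⁺ (Allₚ.map⁺ (All.universal (λ _ → _ , refl) (childSpecs e)))

children-unique : (e : Avoider n) → Unique (mapL perm (children e))
children-unique e = AllPairsₚ.map⁺ (AllPairsₚ.map⁺ (AllPairs.map insertMax-apart (AllPairsₚ.map⁻ positions-unique)))
  where
    positions-unique : Unique (mapL position (childSpecs e))
    positions-unique = subst Unique (sym (proj₂ (childSpecs-shape e)))
      (Uniqueₚ.applyUpTo⁺₁ _ _ (λ j<k _ → <⇒≢ (+-monoˡ-< (lowestPosition e) j<k)))

children-complete : (e : Avoider n) (i : Fin (suc n)) → toℕ i ≤ wedgeBoundOf e → ascentBoundOf e ≤ suc (toℕ i) →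
  insertMax (perm e) i ∈ mapL perm (children e)
children-complete e i i≤q r≤1+i
  with ∈-map⁻ position (subst (toℕ i ∈_) (sym (proj₂ (childSpecs-shape e))) i∈positions)
  where
    b = lowestPosition e
    b≤i : b ≤ toℕ i
    b≤i = pred-mono-≤ r≤1+i
    c = length (childLabels (label e))
    i∈positions : toℕ i ∈ applyUpTo (_+ b) c
    i∈positions = subst (_∈ applyUpTo (_+ b) c) (m∸n+n≡m b≤i) (∈-applyUpTo⁺ (_+ b) (+-cancelʳ-< b _ _
      (subst₂ _<_ (sym (m∸n+n≡m b≤i)) (sym (childLabels-count e)) (s≤s i≤q))))
... | s , s∈ , i≡position = subst (_∈ _) (cong (insertMax (perm e)) (sym i≡s))
  (∈-map⁺ perm (∈-map⁺ (child e) s∈))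
  where
    i≡s : i ≡ fromℕ< _
    i≡s = Finₚ.toℕ-injective (trans i≡position (sym (Finₚ.toℕ-fromℕ< _)))

children-disjoint : {e e′ : Avoider n} → perm e ≢ perm e′ → Disjoint (mapL perm (children e)) (mapL perm (children e′))
children-disjoint {e = e} {e′} e≢e′ (π∈ , π∈′)
  with All.lookup (children-insertMax e) π∈ | All.lookup (children-insertMax e′) π∈′
... | _ , π≡ | _ , π≡′ = e≢e′ (proj₂ (insertMax-injective (trans (sym π≡) π≡′)))

root : Avoider 0
root = avoider [] (λ { {()} }) (λ { (() , _) }) desc₀ 0 record
  { q≤n           = z≤n
  ; ascentFrom    = λ ()
  ; noAscentFrom  = λ _ → λ { (() , _) }
  ; wedgeBefore   = λ 0<t t≤0 → ⊥-elim (<⇒≱ 0<t t≤0)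
  ; noWedgeBefore = λ _ → λ { (() , _) }
  }

level : ∀ n → List (Avoider n)
level zero    = root ∷ []
level (suc n) = concatMap children (level n)

avoiders : ∀ n → List (Vec (Fin n) n)
avoiders n = mapL perm (level n)

avoiders-suc : ∀ n → avoiders (suc n) ≡ concatMap (mapL perm ∘ children) (level n)
avoiders-suc n = Listₚ.map-concatMap perm children (level n)

avoiders-unique : ∀ n → Unique (avoiders n)
avoiders-unique zero    = [] ∷ []
avoiders-unique (suc n) = subst Unique (sym (avoiders-suc n)) (Uniqueₚ.concat⁺
  (Allₚ.map⁺ (All.universal children-unique (level n)))
  (AllPairsₚ.map⁺ (AllPairs.map children-disjoint (AllPairsₚ.map⁻ (avoiders-unique n)))))

avoiders-avoid : ∀ n → All AvoidingPerm (avoiders n)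
avoiders-avoid n = Allₚ.map⁺ (All.universal (λ e → (λ {_} {_} → isPerm e) , avoids e) (level n))

avoiders-complete : ∀ n (π : Vec (Fin n) n) → AvoidingPerm π → π ∈ avoiders n
avoiders-complete zero    []  _                   = here refl
avoiders-complete (suc n) π (π-perm , π-avoids) with isPerm⇒insertMax π π-perm
... | i , τ , τ-perm , refl
  with ∈-map⁻ perm (avoiders-complete n τ (τ-perm , InsertMax.avoids-lower τ i π-avoids))
... | e , e∈ , refl with InsertMax.avoids⁻ (perm e) i (thresholds e) π-avoids
... | i≤q , r≤1+i = subst (insertMax (perm e) i ∈_) (sym (avoiders-suc n))
  (∈-concat⁺′ (children-complete e i i≤q r≤1+i) (∈-map⁺ (mapL perm ∘ children) e∈))

-- Counting

labelsAt : ℕ → List Label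
labelsAt zero    = desc₀ ∷ []
labelsAt (suc n) = concatMap childLabels (labelsAt n)

level-labels : ∀ n → mapL label (level n) ≡ labelsAt n
level-labels zero    = refl
level-labels (suc n) = begin
  mapL label (concatMap children (level n))     ≡⟨ Listₚ.map-concatMap label children (level n) ⟩
  concatMap (mapL label ∘ children) (level n)   ≡⟨ Listₚ.concatMap-cong children-labels (level n) ⟩
  concatMap (childLabels ∘ label) (level n)     ≡⟨ Listₚ.concatMap-map childLabels label (level n) ⟨
  concatMap childLabels (mapL label (level n))  ≡⟨ cong (concatMap childLabels) (level-labels n) ⟩
  labelsAt (suc n)                              ∎
  where open ≡-Reasoning

count : ℕ → ℕ
count n = length (labelsAt n)

numAvoiders : ∀ n → NumAvoiders n (count n)
numAvoiders n = avoiders n , avoiders-unique n , avoiders-avoid n , avoiders-complete n ,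
  trans (Listₚ.length-map perm (level n)) (trans (sym (Listₚ.length-map label (level n))) (cong length (level-labels n)))

total : (Label → ℕ) → List Label → ℕ
total w ls = sum (mapL w ls)

total-concatMap : ∀ w f ls → total w (concatMap f ls) ≡ total (total w ∘ f) ls
total-concatMap w f []       = refl
total-concatMap w f (l ∷ ls) =
  trans (cong sum (Listₚ.map-++ w (f l) (concatMap f ls)))
    (trans (sum-++ (mapL w (f l)) _) (cong (_+_ (total w (f l))) (total-concatMap w f ls)))

total-cong : ∀ {v w} → (∀ l → v l ≡ w l) → ∀ ls → total v ls ≡ total w ls
total-cong v≗w ls = cong sum (Listₚ.map-cong v≗w ls)

total-+ : ∀ v w ls → total (λ l → v l + w l) ls ≡ total v ls + total w ls
total-+ v w []       = refl
total-+ v w (l ∷ ls) = trans (cong (_+_ (v l + w l)) (total-+ v w ls)) (+-exchange (v l) (w l) _ _)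
  where
    +-exchange : ∀ a b c d → a + b + (c + d) ≡ a + c + (b + d)
    +-exchange = solve-∀

total-* : ∀ k w ls → total (λ l → k * w l) ls ≡ k * total w ls
total-* k w []       = sym (*-zeroʳ k)
total-* k w (l ∷ ls) = trans (cong (_+_ (k * w l)) (total-* k w ls)) (sym (*-distribˡ-+ k (w l) _))

length≡total : ∀ ls → length ls ≡ total (const 1) ls
length≡total []       = refl
length≡total (_ ∷ ls) = cong suc (length≡total ls)

isDesc : Label → ℕ
isDesc desc₀ = 1
isDesc desc₁ = 1
isDesc desc₂ = 1
isDesc gap₀  = 0
isDesc gap₁  = 0
isDesc gap₂  = 0

childCount grandchildCount : Label → ℕ
childCount      l = total (const 1) (childLabels l)
grandchildCount l = total childCount (childLabels l)

grandchildCount-recurrence : ∀ l → grandchildCount l + 3 ≡ 4 * childCount l + isDesc l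
grandchildCount-recurrence desc₀ = refl
grandchildCount-recurrence desc₁ = refl
grandchildCount-recurrence desc₂ = refl
grandchildCount-recurrence gap₀  = refl
grandchildCount-recurrence gap₁  = refl
grandchildCount-recurrence gap₂  = refl

isDesc-children : ∀ l → total isDesc (childLabels l) ≡ isDesc l
isDesc-children desc₀ = refl
isDesc-children desc₁ = refl
isDesc-children desc₂ = refl
isDesc-children gap₀  = refl
isDesc-children gap₁  = refl
isDesc-children gap₂  = refl

isDesc-labelsAt : ∀ n → total isDesc (labelsAt n) ≡ 1
isDesc-labelsAt zero    = refl
isDesc-labelsAt (suc n) =
  trans (total-concatMap isDesc childLabels (labelsAt n)) (trans (total-cong isDesc-children (labelsAt n)) (isDesc-labelsAt n))

count-suc : ∀ n → count (suc n) ≡ total childCount (labelsAt n)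
count-suc n = trans (length≡total (labelsAt (suc n))) (total-concatMap (const 1) childLabels (labelsAt n))

count-suc-suc : ∀ n → count (suc (suc n)) ≡ total grandchildCount (labelsAt n)
count-suc-suc n = trans (count-suc (suc n)) (total-concatMap childCount childLabels (labelsAt n))

count-recurrence : ∀ n → count (2 + n) + 3 * count n ≡ 4 * count (1 + n) + 1
count-recurrence n = begin
  count (2 + n) + 3 * count n                         ≡⟨ cong₂ (λ x y → x + 3 * y) (count-suc-suc n) (length≡total ls) ⟩
  total grandchildCount ls + 3 * total (const 1) ls   ≡⟨ cong (_+_ (total grandchildCount ls)) (total-* 3 (const 1) ls) ⟨
  total grandchildCount ls + total (const 3) ls       ≡⟨ total-+ grandchildCount (const 3) ls ⟨
  total (λ l → grandchildCount l + 3) ls              ≡⟨ total-cong grandchildCount-recurrence ls ⟩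
  total (λ l → 4 * childCount l + isDesc l) ls        ≡⟨ total-+ (λ l → 4 * childCount l) isDesc ls ⟩
  total (λ l → 4 * childCount l) ls + total isDesc ls ≡⟨ cong₂ _+_ (total-* 4 childCount ls) (isDesc-labelsAt n) ⟩
  4 * total childCount ls + 1                         ≡⟨ cong (λ x → 4 * x + 1) (count-suc n) ⟨
  4 * count (1 + n) + 1                               ∎
  where
    open ≡-Reasoning
    ls = labelsAt n

ClosedForm : ℕ → Set
ClosedForm n = 4 * count n + 2 * n ≡ 3 ^ n + 3

closedForm-step : ∀ n → ClosedForm n → ClosedForm (1 + n) → ClosedForm (2 + n)
closedForm-step n hₙ h₁₊ₙ = +-cancelʳ-≡ (3 * (3 ^ n + 3)) _ _ (begin
  4 * a₂ + 2 * (2 + n) + 3 * (3 ^ n + 3)         ≡⟨ cong (λ x → 4 * a₂ + 2 * (2 + n) + 3 * x) hₙ ⟨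
  4 * a₂ + 2 * (2 + n) + 3 * (4 * a₀ + 2 * n)    ≡⟨ group-recurrence a₂ a₀ n ⟩
  4 * (a₂ + 3 * a₀) + 8 * n + 4                  ≡⟨ cong (λ x → 4 * x + 8 * n + 4) (count-recurrence n) ⟩
  4 * (4 * a₁ + 1) + 8 * n + 4                   ≡⟨ ungroup-recurrence a₁ n ⟩
  4 * (4 * a₁ + 2 * (1 + n))                     ≡⟨ cong (4 *_) h₁₊ₙ ⟩
  4 * (3 * 3 ^ n + 3)                            ≡⟨ power-split (3 ^ n) ⟩
  3 * (3 * 3 ^ n) + 3 + 3 * (3 ^ n + 3)          ∎)
  where
    open ≡-Reasoning
    a₀ = count n
    a₁ = count (1 + n)
    a₂ = count (2 + n)
    group-recurrence : ∀ x y k → 4 * x + 2 * (2 + k) + 3 * (4 * y + 2 * k) ≡ 4 * (x + 3 * y) + 8 * k + 4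
    group-recurrence = solve-∀
    ungroup-recurrence : ∀ x k → 4 * (4 * x + 1) + 8 * k + 4 ≡ 4 * (4 * x + 2 * (1 + k))
    ungroup-recurrence = solve-∀
    power-split : ∀ p → 4 * (3 * p + 3) ≡ 3 * (3 * p) + 3 + 3 * (p + 3)
    power-split = solve-∀

closedForm : ∀ n → ClosedForm n
closedForm n = proj₁ (closedForms n)
  where
    closedForms : ∀ n → ClosedForm n × ClosedForm (suc n)
    closedForms zero    = refl , refl
    closedForms (suc n) = let hₙ , h₁₊ₙ = closedForms n in h₁₊ₙ , closedForm-step n hₙ h₁₊ₙ

toℤ-recurrence : ∀ x y z → x + 3 * y ≡ 4 * z + 1 → + x +ℤ + 3 *ℤ + y ≡ + 4 *ℤ + z +ℤ + 1
toℤ-recurrence x y z eq = begin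
  + x +ℤ + 3 *ℤ + y  ≡⟨ cong (_+ℤ_ (+ x)) (ℤₚ.pos-* 3 y) ⟨
  + x +ℤ + (3 * y)   ≡⟨ ℤₚ.pos-+ x (3 * y) ⟨
  + (x + 3 * y)      ≡⟨ cong +_ eq ⟩
  + (4 * z + 1)      ≡⟨ ℤₚ.pos-+ (4 * z) 1 ⟩
  + (4 * z) +ℤ + 1   ≡⟨ cong (_+ℤ + 1) (ℤₚ.pos-* 4 z) ⟩
  + 4 *ℤ + z +ℤ + 1  ∎
  where open ≡-Reasoning

-- The coefficients of (1 - 3x)(1 - x)² = 1 - 5x + 7x² - 3x³, the denominator of the generating function.
count-denominator : ∀ n →
  + count (3 + n) -ℤ + 5 *ℤ + count (2 + n) +ℤ + 7 *ℤ + count (1 + n) -ℤ + 3 *ℤ + count n ≡ + 0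
count-denominator n = begin
  a₃ -ℤ + 5 *ℤ a₂ +ℤ + 7 *ℤ a₁ -ℤ + 3 *ℤ a₀               ≡⟨ difference a₀ a₁ a₂ a₃ ⟩
  (a₃ +ℤ + 3 *ℤ a₁) -ℤ (a₂ +ℤ + 3 *ℤ a₀) -ℤ + 4 *ℤ a₂ +ℤ + 4 *ℤ a₁
    ≡⟨ cong₂ (λ u v → u -ℤ v -ℤ + 4 *ℤ a₂ +ℤ + 4 *ℤ a₁)
             (toℤ-recurrence (count (3 + n)) (count (1 + n)) (count (2 + n)) (count-recurrence (1 + n)))
             (toℤ-recurrence (count (2 + n)) (count n) (count (1 + n)) (count-recurrence n)) ⟩
  (+ 4 *ℤ a₂ +ℤ + 1) -ℤ (+ 4 *ℤ a₁ +ℤ + 1) -ℤ + 4 *ℤ a₂ +ℤ + 4 *ℤ a₁ ≡⟨ cancellation a₁ a₂ ⟩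
  + 0                                                      ∎
  where
    open ≡-Reasoning
    a₀ = + count n
    a₁ = + count (1 + n)
    a₂ = + count (2 + n)
    a₃ = + count (3 + n)
    difference : ∀ x₀ x₁ x₂ x₃ → x₃ -ℤ + 5 *ℤ x₂ +ℤ + 7 *ℤ x₁ -ℤ + 3 *ℤ x₀ ≡
      (x₃ +ℤ + 3 *ℤ x₁) -ℤ (x₂ +ℤ + 3 *ℤ x₀) -ℤ + 4 *ℤ x₂ +ℤ + 4 *ℤ x₁
    difference = ℤ-Solver.solve-∀
    cancellation : ∀ x₁ x₂ → (+ 4 *ℤ x₂ +ℤ + 1) -ℤ (+ 4 *ℤ x₁ +ℤ + 1) -ℤ + 4 *ℤ x₂ +ℤ + 4 *ℤ x₁ ≡ + 0
    cancellation = ℤ-Solver.solve-∀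

theorem21 : Σ (ℕ → ℕ) λ a →
    (∀ n → NumAvoiders n (a n))
    × a 0 ≡ 1 × a 1 ≡ 1
    × (∀ n → a (2 + n) + 3 * a n ≡ 4 * a (1 + n) + 1)
    × (∀ n → 4 * a n + 2 * n ≡ 3 ^ n + 3)
    × (+ a 0 ≡ + 1)
    × (+ a 1 -ℤ + 5 *ℤ + a 0 ≡ -ℤ + 4)
    × (+ a 2 -ℤ + 5 *ℤ + a 1 +ℤ + 7 *ℤ + a 0 ≡ + 4)
    × (∀ n → + a (3 + n) -ℤ + 5 *ℤ + a (2 + n) +ℤ + 7 *ℤ + a (1 + n) -ℤ + 3 *ℤ + a n ≡ + 0)
theorem21 =
  count , numAvoiders , refl , refl , count-recurrence , closedForm , refl , refl , refl , count-denominator
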